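{- Let $G$ be a finite simple graph that is a cograph or a split graph. Then $G$ has a unique perfect matching if and only if some set $U\subseteq V(G)$ forces a unique perfect matching in $G$.
   Context: A cograph is a graph with no induced path on four vertices. A split graph is a graph whose vertex set can be partitioned into an independent set and a clique. For a graph $G$ with $n(G)$ vertices, a set $U=\{u_1,\ldots,u_k\}$ (with a given ordering) is said to force a unique perfect matching in $G$ if $n(G)=2k$ and $d_{G_i}(u_i)=1$ for every $i\in\{1,\ldots,k\}$, where $G_i=G-\bigcup_{j=1}^{i-1}N_G[u_j]$ and $N_G[u]$ denotes the closed neighborhood of $u$ in $G$. (A set "forces a unique perfect matching" if it admits such an ordering.) -}

module Defs where

open import Data.Nat using (ℕ; zero; suc; _+_; _*_)
open import Data.Fin using (Fin; zero; suc; _<?_; _≟_)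
open import Data.Bool using (Bool; true; false; _∨_; _∧_; not; if_then_else_)
open import Data.Product using (Σ; ∃; _×_; _,_)
open import Relation.Nullary using (¬_)
open import Relation.Nullary.Decidable using (⌊_⌋)
open import Relation.Binary.PropositionalEquality using (_≡_; _≢_)
open import Function.Definitions using (Injective)

record Graph (n : ℕ) : Set where
  field
    adj    : Fin n → Fin n → Bool
    sym    : ∀ u v → adj u v ≡ adj v u
    irrefl : ∀ v → adj v v ≡ false
open Graph public

Adj : ∀ {n} → Graph n → Fin n → Fin n → Set
Adj G u v = adj G u v ≡ true

InducedP4 : ∀ {n} → Graph n → Fin n → Fin n → Fin n → Fin n → Set
InducedP4 G a b c d =
  (a ≢ b) × (a ≢ c) × (a ≢ d) × (b ≢ c) × (b ≢ d) × (c ≢ d) ×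
  Adj G a b × Adj G b c × Adj G c d ×
  (¬ Adj G a c) × (¬ Adj G b d) × (¬ Adj G a d)

IsCograph : ∀ {n} → Graph n → Set
IsCograph {n} G = ¬ (Σ (Fin n) λ a → Σ (Fin n) λ b → Σ (Fin n) λ c → Σ (Fin n) λ d →
  InducedP4 G a b c d)

IsSplit : ∀ {n} → Graph n → Set
IsSplit {n} G = Σ (Fin n → Bool) λ S →
  (∀ u v → S u ≡ true → S v ≡ true → u ≢ v → Adj G u v) ×
  (∀ u v → S u ≡ false → S v ≡ false → ¬ Adj G u v)

record PerfectMatching {n : ℕ} (G : Graph n) : Set where
  field
    M       : Fin n → Fin n → Bool
    M-sym   : ∀ u v → M u v ≡ M v u
    M-edges : ∀ u v → M u v ≡ true → Adj G u v
    cover   : ∀ v → Σ (Fin n) λ w → (M v w ≡ true) × (∀ w' → M v w' ≡ true → w' ≡ w)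
open PerfectMatching public

HasUniquePM : ∀ {n} → Graph n → Set
HasUniquePM {n} G = PerfectMatching G ×
  (∀ (P Q : PerfectMatching G) → ∀ u v → M P u v ≡ M Q u v)

count : ∀ {n} → (Fin n → Bool) → ℕ
count {zero}  p = 0
count {suc n} p = (if p zero then 1 else 0) + count (λ i → p (suc i))

anyFin : ∀ {n} → (Fin n → Bool) → Bool
anyFin {zero}  p = false
anyFin {suc n} p = p zero ∨ anyFin (λ i → p (suc i))

inClosedNbhd : ∀ {n} → Graph n → Fin n → Fin n → Bool
inClosedNbhd G u w = ⌊ u ≟ w ⌋ ∨ adj G u w

-- w ∈ V(G_i), where G_i = G - ⋃_{j<i} N_G[u_j]
inGi : ∀ {n k} → Graph n → (Fin k → Fin n) → Fin k → Fin n → Bool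
inGi G u i w = not (anyFin (λ j → ⌊ j <? i ⌋ ∧ inClosedNbhd G (u j) w))

-- The set U = {u_1,…,u_k} (ordering given by the index in Fin k, elements
-- distinct) forces a unique perfect matching in G: n = 2k, and for every i,
-- u_i is a vertex of G_i and its degree in G_i is 1.
Forces : ∀ {n k} → Graph n → (Fin k → Fin n) → Set
Forces {n} {k} G u =
  Injective _≡_ _≡_ u × (n ≡ 2 * k) ×
  (∀ i → (inGi G u i (u i) ≡ true) ×
         (count (λ w → adj G (u i) w ∧ inGi G u i w) ≡ 1))

SomeSetForcesUPM : ∀ {n} → Graph n → Set
SomeSetForcesUPM {n} G = Σ ℕ λ k → Σ (Fin k → Fin n) λ u → Forces G u

module Submission where

-- (⇐) holds for every graph.  If U = u₀,…,u_{k-1} forces, let vᵢ be the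
-- unique neighbour of uᵢ in Gᵢ.  Removing N[uᵢ] from Gᵢ deletes exactly uᵢ
-- and vᵢ, so the 2k vertices u₀,v₀,…,u_{k-1},v_{k-1} are all of V(G) and
-- the edges uᵢvᵢ form a perfect matching; by induction on i every perfect
-- matching pairs uᵢ with vᵢ, so it is the only one.
--
-- (⇒) Let p be the partner map of the unique perfect matching.  Uniqueness
-- forbids every alternating cycle, in particular alternating squares and
-- fixed-point-free self-maps f of a set X (disjoint from p X) with
-- x ~ p (f x).  From this we show the "pendant lemma": in a cograph or a
-- split graph every nonempty p-closed vertex set S contains a vertex whose
-- only neighbour in S is its partner.  Greedily choosing such a vertex of
-- the current remaining set and deleting its closed neighbourhood (which
-- removes exactly it and its partner, keeping the set p-closed) produces a
-- forcing sequence of length n/2.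

open import Defs
open import Data.Nat using (ℕ)
open import Data.Sum using (_⊎_)
open import Data.Product using (_×_)

open import Data.Nat as ℕ using (zero; suc; _+_; _*_; _≤_; _<_; z≤n; s≤s)
import Data.Nat.Properties as NP
import Data.Fin.Properties as FP
open import Data.Fin as F using (Fin; zero; suc; toℕ; _≟_)
open import Data.Bool using (Bool; true; false; _∨_; _∧_; not; if_then_else_)
import Data.Bool.Properties as BP
open import Data.Product using (Σ; _,_; proj₁; proj₂)
open import Data.Sum using (inj₁; inj₂; [_,_])
open import Data.Empty using (⊥; ⊥-elim)
open import Relation.Nullary using (¬_; Dec; yes; no)
open import Relation.Nullary.Decidable using (⌊_⌋)
open import Relation.Binary using (tri<; tri≈; tri>)
open import Relation.Binary.PropositionalEquality hiding ([_]) renaming (sym to esym)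

from-yes : ∀ {a} {A : Set a} (d : Dec A) → ⌊ d ⌋ ≡ true → A
from-yes (yes x) _ = x
from-yes (no _) ()

from-no : ∀ {a} {A : Set a} (d : Dec A) → ⌊ d ⌋ ≡ false → ¬ A
from-no (yes _) ()
from-no (no x) _ = x

to-yes : ∀ {a} {A : Set a} (d : Dec A) → A → ⌊ d ⌋ ≡ true
to-yes (yes _) _ = refl
to-yes (no ¬x) x = ⊥-elim (¬x x)

to-no : ∀ {a} {A : Set a} (d : Dec A) → ¬ A → ⌊ d ⌋ ≡ false
to-no (yes x) ¬x = ⊥-elim (¬x x)
to-no (no _) _ = refl

bool-ext : ∀ {a b : Bool} → (a ≡ true → b ≡ true) → (b ≡ true → a ≡ true) → a ≡ b
bool-ext {false} {false} _ _ = refl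
bool-ext {false} {true}  _ g with () ← g refl
bool-ext {true}  {false} f _ with () ← f refl
bool-ext {true}  {true}  _ _ = refl

bool-cases : ∀ {a} {A : Set a} (b : Bool) → (b ≡ true → A) → (b ≡ false → A) → A
bool-cases true  t _ = t refl
bool-cases false _ f = f refl

true-and-false : ∀ {a : Bool} → a ≡ true → a ≡ false → ⊥
true-and-false refl ()

¬true⇒false : ∀ {a : Bool} → ¬ (a ≡ true) → a ≡ false
¬true⇒false {false} _ = refl
¬true⇒false {true}  n = ⊥-elim (n refl)

false⇒¬true : ∀ {a : Bool} → a ≡ false → ¬ (a ≡ true)
false⇒¬true refl ()

¬false⇒true : ∀ {a : Bool} → ¬ (a ≡ false) → a ≡ true
¬false⇒true {true}  _ = refl
¬false⇒true {false} n = ⊥-elim (n refl)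

∧-true₁ : ∀ {a b} → a ∧ b ≡ true → a ≡ true
∧-true₁ {true} _ = refl

∧-true₂ : ∀ {a b} → a ∧ b ≡ true → b ≡ true
∧-true₂ {true} e = e

∧-true : ∀ {a b} → a ≡ true → b ≡ true → a ∧ b ≡ true
∧-true refl refl = refl

∨-true : ∀ {a b} → a ∨ b ≡ true → (a ≡ true) ⊎ (b ≡ true)
∨-true {true}  _ = inj₁ refl
∨-true {false} e = inj₂ e

∨-trueˡ : ∀ {a b} → a ≡ true → a ∨ b ≡ true
∨-trueˡ refl = refl

∨-trueʳ : ∀ {a b} → b ≡ true → a ∨ b ≡ true
∨-trueʳ {true}  _ = refl
∨-trueʳ {false} e = e

not≡true⇒ : ∀ {a} → not a ≡ true → a ≡ false
not≡true⇒ {false} _ = refl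

⇒not≡true : ∀ {a} → a ≡ false → not a ≡ true
⇒not≡true refl = refl

not≡false⇒ : ∀ {a} → not a ≡ false → a ≡ true
not≡false⇒ {true} _ = refl

count-cong : ∀ {n} {p q : Fin n → Bool} → (∀ w → p w ≡ q w) → count p ≡ count q
count-cong {zero}  e = refl
count-cong {suc n} e rewrite e zero = cong (_ +_) (count-cong (λ w → e (suc w)))

count-const-true : ∀ n → count {n} (λ _ → true) ≡ n
count-const-true zero    = refl
count-const-true (suc n) = cong suc (count-const-true n)

count-none : ∀ {n} (p : Fin n → Bool) → (∀ w → p w ≡ false) → count p ≡ 0
count-none {zero}  p f = refl
count-none {suc n} p f rewrite f zero = count-none (λ i → p (suc i)) (λ w → f (suc w))

count≡0⇒false : ∀ {n} (p : Fin n → Bool) → count p ≡ 0 → ∀ w → p w ≡ false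
count≡0⇒false {suc n} p c w with p zero in eq
count≡0⇒false {suc n} p ()  w       | true
count≡0⇒false {suc n} p c   zero    | false = eq
count≡0⇒false {suc n} p c   (suc w) | false = count≡0⇒false (λ i → p (suc i)) c w

count-witness : ∀ {n} (p : Fin n → Bool) {m} → count p ≡ suc m → Σ (Fin n) λ w → p w ≡ true
count-witness {zero} p ()
count-witness {suc n} p c with p zero in eq
... | true  = zero , eq
... | false with count-witness (λ i → p (suc i)) c
...   | w , e = suc w , e

count-single : ∀ {n} (p : Fin n → Bool) (a : Fin n) → p a ≡ true →
  (∀ w → p w ≡ true → w ≡ a) → count p ≡ 1
count-single {suc n} p zero pa u rewrite pa =
  cong suc (count-none (λ i → p (suc i)) (λ w → ¬true⇒false (λ e → suc≢zero (u (suc w) e))))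
  where
    suc≢zero : ∀ {w : Fin n} → suc w ≢ zero
    suc≢zero ()
count-single {suc n} p (suc a) pa u with p zero in eq
... | true with () ← u zero eq
... | false = count-single (λ i → p (suc i)) a pa (λ w e → FP.suc-injective (u (suc w) e))

count≡1⇒unique : ∀ {n} (p : Fin n → Bool) → count p ≡ 1 →
  ∀ a b → p a ≡ true → p b ≡ true → a ≡ b
count≡1⇒unique {suc n} p c a b pa pb with p zero in eq
count≡1⇒unique {suc n} p c zero    zero    pa pb | true  = refl
count≡1⇒unique {suc n} p c zero    (suc b) pa pb | true  =
  ⊥-elim (true-and-false pb (count≡0⇒false (λ i → p (suc i)) (NP.suc-injective c) b))
count≡1⇒unique {suc n} p c (suc a) b       pa pb | true  =
  ⊥-elim (true-and-false pa (count≡0⇒false (λ i → p (suc i)) (NP.suc-injective c) a))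
count≡1⇒unique {suc n} p c zero    b       pa pb | false = ⊥-elim (true-and-false pa eq)
count≡1⇒unique {suc n} p c (suc a) zero    pa pb | false = ⊥-elim (true-and-false pb eq)
count≡1⇒unique {suc n} p c (suc a) (suc b) pa pb | false =
  cong suc (count≡1⇒unique (λ i → p (suc i)) c a b pa pb)

count-split : ∀ {n} (p q : Fin n → Bool) →
  count p ≡ count (λ w → p w ∧ q w) + count (λ w → p w ∧ not (q w))
count-split {zero} p q = refl
count-split {suc n} p q with p zero | q zero | count-split (λ i → p (suc i)) (λ i → q (suc i))
... | false | _     | ih = ih
... | true  | true  | ih = cong suc ih
... | true  | false | ih = trans (cong suc ih) (esym (NP.+-suc _ _))

count-mono : ∀ {n} (p q : Fin n → Bool) → (∀ w → p w ≡ true → q w ≡ true) → count p ≤ count q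
count-mono {zero} p q f = z≤n
count-mono {suc n} p q f with p zero in ep | q zero in eq
... | true  | true  = s≤s (count-mono _ _ (λ w → f (suc w)))
... | true  | false = ⊥-elim (true-and-false (f zero ep) eq)
... | false | true  = NP.m≤n⇒m≤1+n (count-mono _ _ (λ w → f (suc w)))
... | false | false = count-mono _ _ (λ w → f (suc w))

count-strict : ∀ {n} (p q : Fin n → Bool) → (∀ w → p w ≡ true → q w ≡ true) →
  ∀ a → q a ≡ true → p a ≡ false → count p < count q
count-strict {suc n} p q f zero qa pa with p zero | q zero
... | true  | _     = ⊥-elim (true-and-false refl pa)
... | false | false = ⊥-elim (true-and-false qa refl)
... | false | true  = s≤s (count-mono _ _ (λ w → f (suc w)))
count-strict {suc n} p q f (suc a) qa pa with p zero in ep | q zero in eq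
... | true  | true  = s≤s (count-strict _ _ (λ w → f (suc w)) a qa pa)
... | true  | false = ⊥-elim (true-and-false (f zero ep) eq)
... | false | true  = NP.m≤n⇒m≤1+n (count-strict _ _ (λ w → f (suc w)) a qa pa)
... | false | false = count-strict _ _ (λ w → f (suc w)) a qa pa

anyFin-witness : ∀ {k} (p : Fin k → Bool) → anyFin p ≡ true → Σ (Fin k) λ j → p j ≡ true
anyFin-witness {zero} p ()
anyFin-witness {suc k} p e with p zero in eq
... | true  = zero , eq
... | false with anyFin-witness (λ i → p (suc i)) e
...   | j , ej = suc j , ej

anyFin-intro : ∀ {k} (p : Fin k → Bool) (j : Fin k) → p j ≡ true → anyFin p ≡ true
anyFin-intro p zero    e rewrite e = refl
anyFin-intro p (suc j) e = ∨-trueʳ (anyFin-intro (λ i → p (suc i)) j e)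

anyFin≡false⇒ : ∀ {k} (p : Fin k → Bool) → anyFin p ≡ false → ∀ j → p j ≡ false
anyFin≡false⇒ p e j = ¬true⇒false (λ t → true-and-false (anyFin-intro p j t) e)

anyFin-none : ∀ {k} (p : Fin k → Bool) → (∀ j → p j ≡ false) → anyFin p ≡ false
anyFin-none p f = ¬true⇒false (λ t → let (j , e) = anyFin-witness p t in true-and-false e (f j))

search : ∀ {n} → (Fin n → Bool) → Fin n → Fin n
search p d with FP.any? (λ w → p w BP.≟ true)
... | yes (w , _) = w
... | no _        = d

search-ok : ∀ {n} (p : Fin n → Bool) d w → p w ≡ true → p (search p d) ≡ true
search-ok p d w e with FP.any? (λ w → p w BP.≟ true)
... | yes (_ , ok) = ok
... | no none      = ⊥-elim (none (w , e))

-- Perfect matchings as fixed-point-free involutions along edges.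

module Matchings {n : ℕ} (G : Graph n) where

  adj-sym : ∀ {u v} → Adj G u v → Adj G v u
  adj-sym {u} {v} e = trans (Graph.sym G v u) e

  nonadj-sym : ∀ {u v} → ¬ Adj G u v → ¬ Adj G v u
  nonadj-sym n e = n (adj-sym e)

  adj⇒≢ : ∀ {u v} → Adj G u v → u ≢ v
  adj⇒≢ {u} e refl = true-and-false e (irrefl G u)

  AtMostOneMatching : Set
  AtMostOneMatching = ∀ (P Q : PerfectMatching G) → ∀ u v → M P u v ≡ M Q u v

  partner : PerfectMatching G → Fin n → Fin n
  partner P x = proj₁ (cover P x)

  partner-matched : ∀ P x → M P x (partner P x) ≡ true
  partner-matched P x = proj₁ (proj₂ (cover P x))

  partner-unique : ∀ P x y → M P x y ≡ true → y ≡ partner P x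
  partner-unique P x y e = proj₂ (proj₂ (cover P x)) y e

  partner-involutive : ∀ P x → partner P (partner P x) ≡ x
  partner-involutive P x =
    esym (partner-unique P (partner P x) x (trans (M-sym P _ _) (partner-matched P x)))

  partner-adjacent : ∀ P x → Adj G x (partner P x)
  partner-adjacent P x = M-edges P _ _ (partner-matched P x)

  involutionMatching : (q : Fin n → Fin n) → (∀ x → q (q x) ≡ x) → (∀ x → Adj G x (q x)) →
    PerfectMatching G
  involutionMatching q qq qa = record
    { M       = λ u v → ⌊ v ≟ q u ⌋
    ; M-sym   = λ u v → bool-ext (flip u v) (flip v u)
    ; M-edges = λ u v e → subst (Adj G u) (esym (from-yes (v ≟ q u) e)) (qa u)
    ; cover   = λ v → q v , to-yes (q v ≟ q v) refl , (λ w e → from-yes (w ≟ q v) e)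
    }
    where
      flip : ∀ u v → ⌊ v ≟ q u ⌋ ≡ true → ⌊ u ≟ q v ⌋ ≡ true
      flip u v e = to-yes (u ≟ q v) (esym (trans (cong q (from-yes (v ≟ q u) e)) (qq u)))

  involution-is-partner : (P₀ : PerfectMatching G) → AtMostOneMatching →
    (q : Fin n → Fin n) → (∀ x → q (q x) ≡ x) → (∀ x → Adj G x (q x)) →
    ∀ x → q x ≡ partner P₀ x
  involution-is-partner P₀ unique q qq qa x =
    partner-unique P₀ x (q x)
      (trans (unique P₀ (involutionMatching q qq qa) x (q x)) (to-yes (q x ≟ q x) refl))

  same-partners⇒same-edges : ∀ (P Q : PerfectMatching G) → (∀ x → partner P x ≡ partner Q x) →
    ∀ x y → M P x y ≡ M Q x y
  same-partners⇒same-edges P Q same x y = bool-ext (transfer P Q same) (transfer Q P (λ z → esym (same z)))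
    where
      transfer : ∀ P Q → (∀ x → partner P x ≡ partner Q x) → M P x y ≡ true → M Q x y ≡ true
      transfer P Q same e =
        subst (λ z → M Q x z ≡ true) (esym (trans (partner-unique P x y e) (same x))) (partner-matched Q x)

-- Alternating structures with respect to a unique perfect matching P₀ with
-- partner map p.  All of them would yield a second perfect matching.

module UniqueMatching {n : ℕ} (G : Graph n) (P₀ : PerfectMatching G)
          (unique : Matchings.AtMostOneMatching G) where
  open Matchings G

  p : Fin n → Fin n
  p = partner P₀

  p-involutive : ∀ x → p (p x) ≡ x
  p-involutive = partner-involutive P₀

  p-adjacent : ∀ x → Adj G x (p x)
  p-adjacent = partner-adjacent P₀

  p-injective : ∀ {x y} → p x ≡ p y → x ≡ y
  p-injective {x} {y} e = trans (esym (p-involutive x)) (trans (cong p e) (p-involutive y))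

  -- Matching
  -- every x ∈ X to p (g x) instead of p x is again a perfect matching, so by
  -- uniqueness g is the identity on X.
  module Rematch (X : Fin n → Bool) (X-disjoint : ∀ x → X x ≡ true → X (p x) ≡ false)
                 (g h : Fin n → Fin n)
                 (g-closed : ∀ x → X x ≡ true → X (g x) ≡ true)
                 (h-closed : ∀ x → X x ≡ true → X (h x) ≡ true)
                 (hg : ∀ x → X x ≡ true → h (g x) ≡ x)
                 (gh : ∀ x → X x ≡ true → g (h x) ≡ x)
                 (g-alternating : ∀ x → X x ≡ true → Adj G x (p (g x))) where

    rematched : Fin n → Fin n
    rematched x = if X x then p (g x) else (if X (p x) then h (p x) else p x)

    rematched-X : ∀ x → X x ≡ true → rematched x ≡ p (g x)
    rematched-X x e rewrite e = refl

    rematched-pX : ∀ x → X x ≡ false → X (p x) ≡ true → rematched x ≡ h (p x)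
    rematched-pX x e e' rewrite e | e' = refl

    rematched-rest : ∀ x → X x ≡ false → X (p x) ≡ false → rematched x ≡ p x
    rematched-rest x e e' rewrite e | e' = refl

    rematched-involutive : ∀ x → rematched (rematched x) ≡ x
    rematched-involutive x = bool-cases (X x) inX λ e → bool-cases (X (p x)) (inpX e) (rest e)
      where
        open ≡-Reasoning
        inX : X x ≡ true → rematched (rematched x) ≡ x
        inX e = begin
          rematched (rematched x) ≡⟨ cong rematched (rematched-X x e) ⟩
          rematched (p (g x))     ≡⟨ rematched-pX (p (g x)) (X-disjoint (g x) (g-closed x e))
                                       (trans (cong X (p-involutive (g x))) (g-closed x e)) ⟩
          h (p (p (g x)))         ≡⟨ cong h (p-involutive (g x)) ⟩
          h (g x)                 ≡⟨ hg x e ⟩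
          x                       ∎
        inpX : X x ≡ false → X (p x) ≡ true → rematched (rematched x) ≡ x
        inpX e e' = begin
          rematched (rematched x) ≡⟨ cong rematched (rematched-pX x e e') ⟩
          rematched (h (p x))     ≡⟨ rematched-X (h (p x)) (h-closed (p x) e') ⟩
          p (g (h (p x)))         ≡⟨ cong p (gh (p x) e') ⟩
          p (p x)                 ≡⟨ p-involutive x ⟩
          x                       ∎
        rest : X x ≡ false → X (p x) ≡ false → rematched (rematched x) ≡ x
        rest e e' = begin
          rematched (rematched x) ≡⟨ cong rematched (rematched-rest x e e') ⟩
          rematched (p x)         ≡⟨ rematched-rest (p x) e' (trans (cong X (p-involutive x)) e) ⟩
          p (p x)                 ≡⟨ p-involutive x ⟩
          x                       ∎

    rematched-adjacent : ∀ x → Adj G x (rematched x)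
    rematched-adjacent x = bool-cases (X x) inX λ e → bool-cases (X (p x)) (inpX e) (rest e)
      where
        inX : X x ≡ true → Adj G x (rematched x)
        inX e = subst (Adj G x) (esym (rematched-X x e)) (g-alternating x e)
        inpX : X x ≡ false → X (p x) ≡ true → Adj G x (rematched x)
        inpX e e' = subst (Adj G x) (esym (rematched-pX x e e')) (adj-sym back)
          where
            back : Adj G (h (p x)) x
            back = subst (Adj G (h (p x))) (trans (cong p (gh (p x) e')) (p-involutive x))
                         (g-alternating (h (p x)) (h-closed (p x) e'))
        rest : X x ≡ false → X (p x) ≡ false → Adj G x (rematched x)
        rest e e' = subst (Adj G x) (esym (rematched-rest x e e')) (p-adjacent x)

    g-identity : ∀ x → X x ≡ true → g x ≡ x
    g-identity x e = p-injective (trans (esym (rematched-X x e))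
      (involution-is-partner P₀ unique rematched rematched-involutive rematched-adjacent x))

  -- An alternating square a ~ c, p a ~ p c with a ≠ p c: the transposition of
  -- X = {a, p c} contradicts Rematch.
  module Square (a c : Fin n) (a≢pc : a ≢ p c) (ac : Adj G a c) (pa-pc : Adj G (p a) (p c)) where
    X : Fin n → Bool
    X x = ⌊ x ≟ a ⌋ ∨ ⌊ x ≟ p c ⌋

    X-a : X a ≡ true
    X-a = ∨-trueˡ (to-yes (a ≟ a) refl)

    X-pc : X (p c) ≡ true
    X-pc = ∨-trueʳ (to-yes (p c ≟ p c) refl)

    X-cases : ∀ x → X x ≡ true → (x ≡ a) ⊎ (x ≡ p c)
    X-cases x e with ∨-true e
    ... | inj₁ e₁ = inj₁ (from-yes (x ≟ a) e₁)
    ... | inj₂ e₂ = inj₂ (from-yes (x ≟ p c) e₂)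

    X-disjoint : ∀ x → X x ≡ true → X (p x) ≡ false
    X-disjoint x e with X-cases x e
    ... | inj₁ refl = ¬true⇒false λ t → [ (λ e₁ → adj⇒≢ (p-adjacent a) (esym e₁))
                                        , (λ e₂ → adj⇒≢ ac (p-injective e₂)) ] (X-cases (p a) t)
    ... | inj₂ refl = ¬true⇒false λ t → [ (λ e₁ → adj⇒≢ ac (esym (trans (esym (p-involutive c)) e₁)))
                                        , (λ e₂ → adj⇒≢ (p-adjacent c) (trans (esym (p-involutive c)) e₂))
                                        ] (X-cases (p (p c)) t)

    swap : Fin n → Fin n
    swap x = if ⌊ x ≟ a ⌋ then p c else a

    swap-a : swap a ≡ p c
    swap-a rewrite to-yes (a ≟ a) refl = refl

    swap-pc : swap (p c) ≡ a
    swap-pc rewrite to-no (p c ≟ a) (λ e → a≢pc (esym e)) = refl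

    swap-closed : ∀ x → X x ≡ true → X (swap x) ≡ true
    swap-closed x e with X-cases x e
    ... | inj₁ refl = subst (λ y → X y ≡ true) (esym swap-a) X-pc
    ... | inj₂ refl = subst (λ y → X y ≡ true) (esym swap-pc) X-a

    swap-involutive : ∀ x → X x ≡ true → swap (swap x) ≡ x
    swap-involutive x e with X-cases x e
    ... | inj₁ refl = trans (cong swap swap-a) swap-pc
    ... | inj₂ refl = trans (cong swap swap-pc) swap-a

    swap-alternating : ∀ x → X x ≡ true → Adj G x (p (swap x))
    swap-alternating x e with X-cases x e
    ... | inj₁ refl = subst (Adj G a) (esym (trans (cong p swap-a) (p-involutive c))) ac
    ... | inj₂ refl = subst (Adj G (p c)) (esym (cong p swap-pc)) (adj-sym pa-pc)

    absurd : ⊥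
    absurd = a≢pc (esym (trans (esym swap-a)
      (Rematch.g-identity X X-disjoint swap swap swap-closed swap-closed
                          swap-involutive swap-involutive swap-alternating a X-a)))

  no-alternating-square : ∀ a c → a ≢ p c → Adj G a c → Adj G (p a) (p c) → ⊥
  no-alternating-square = Square.absurd

  partners-nonadjacent : ∀ {u w} → Adj G u w → w ≢ p u → ¬ Adj G (p u) (p w)
  partners-nonadjacent {u} {w} uw w≢pu =
    no-alternating-square u w (λ eq → w≢pu (trans (esym (p-involutive w)) (cong p (esym eq)))) uw

  no-alternating-square′ : ∀ a c → a ≢ c → Adj G a (p c) → Adj G (p a) c → ⊥
  no-alternating-square′ a c a≢c a-pc pa-c =
    no-alternating-square a (p c) (λ eq → a≢c (trans eq (p-involutive c))) a-pc
      (subst (Adj G (p a)) (esym (p-involutive c)) pa-c)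

  -- A self-map f of a set X disjoint from p X without
  -- fixed points and with x ~ p (f x) cannot exist on a nonempty X: iterating
  -- f from any point eventually runs into a cycle C, and the permutation that
  -- is f on C and the identity elsewhere contradicts Rematch.
  module SelfMap (X : Fin n → Bool) (X-disjoint : ∀ x → X x ≡ true → X (p x) ≡ false)
                 (f : Fin n → Fin n)
                 (f-closed : ∀ x → X x ≡ true → X (f x) ≡ true)
                 (f-moves : ∀ x → X x ≡ true → f x ≢ x)
                 (f-alternating : ∀ x → X x ≡ true → Adj G x (p (f x))) where

    iter : ℕ → Fin n → Fin n
    iter zero    x = x
    iter (suc t) x = f (iter t x)

    iter-+ : ∀ a b x → iter (a + b) x ≡ iter a (iter b x)
    iter-+ zero    b x = refl
    iter-+ (suc a) b x = cong f (iter-+ a b x)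

    iter-f : ∀ a x → iter a (f x) ≡ f (iter a x)
    iter-f zero    x = refl
    iter-f (suc a) x = cong f (iter-f a x)

    iter-closed : ∀ a x → X x ≡ true → X (iter a x) ≡ true
    iter-closed zero    x e = e
    iter-closed (suc a) x e = f-closed _ (iter-closed a x e)

    -- By pigeonhole two of the first n+1 iterates of x₀ agree, giving a
    -- periodic point c of period L+1.
    find-cycle : ∀ x₀ → X x₀ ≡ true →
      Σ (Fin n) λ c → Σ ℕ λ L → (X c ≡ true) × (iter (suc L) c ≡ c)
    find-cycle x₀ e with FP.pigeonhole (NP.n<1+n n) (λ (t : Fin (suc n)) → iter (toℕ t) x₀)
    ... | i , j , i<j , same =
      iter (toℕ i) x₀ , d , iter-closed (toℕ i) x₀ e ,
        trans (esym (iter-+ (suc d) (toℕ i) x₀)) (trans (cong (λ z → iter z x₀) j≡) (esym same))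
      where
        d : ℕ
        d = toℕ j ℕ.∸ suc (toℕ i)
        j≡ : suc d + toℕ i ≡ toℕ j
        j≡ = trans (esym (NP.+-suc d (toℕ i))) (NP.m∸n+n≡m i<j)

    module OnCycle (c : Fin n) (L : ℕ) (X-c : X c ≡ true) (periodic : iter (suc L) c ≡ c) where
      reduce : ∀ t → Σ (Fin (suc L)) λ t' → iter (toℕ t') c ≡ iter t c
      reduce zero = zero , refl
      reduce (suc t) with reduce t
      ... | t' , e with suc (toℕ t') ℕ.<? suc L
      ...   | yes lt = F.fromℕ< lt , trans (cong (λ z → iter z c) (FP.toℕ-fromℕ< lt)) (cong f e)
      ...   | no ¬lt = zero , trans (esym periodic) (trans (cong (λ z → iter (suc z) c) L≡) (cong f e))
        where
          L≡ : L ≡ toℕ t'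
          L≡ = NP.≤-antisym (ℕ.s≤s⁻¹ (NP.≮⇒≥ ¬lt)) (ℕ.s≤s⁻¹ (FP.toℕ<n t'))

      onC : Fin n → Bool
      onC x = anyFin (λ (t : Fin (suc L)) → ⌊ iter (toℕ t) c ≟ x ⌋)

      onC-intro : ∀ t x → iter t c ≡ x → onC x ≡ true
      onC-intro t x e with reduce t
      ... | t' , e' = anyFin-intro (λ (t : Fin (suc L)) → ⌊ iter (toℕ t) c ≟ x ⌋) t'
                        (to-yes (iter (toℕ t') c ≟ x) (trans e' e))

      onC-elim : ∀ x → onC x ≡ true → Σ ℕ λ t → iter t c ≡ x
      onC-elim x e with anyFin-witness (λ (t : Fin (suc L)) → ⌊ iter (toℕ t) c ≟ x ⌋) e
      ... | t , e' = toℕ t , from-yes (iter (toℕ t) c ≟ x) e'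

      onC-f : ∀ x → onC x ≡ true → onC (f x) ≡ true
      onC-f x e with onC-elim x e
      ... | t , refl = onC-intro (suc t) _ refl

      onC-iter : ∀ a x → onC x ≡ true → onC (iter a x) ≡ true
      onC-iter zero    x e = e
      onC-iter (suc a) x e = onC-f _ (onC-iter a x e)

      onC-periodic : ∀ x → onC x ≡ true → iter (suc L) x ≡ x
      onC-periodic x e with onC-elim x e
      ... | t , refl = begin
        iter (suc L) (iter t c) ≡⟨ esym (iter-+ (suc L) t c) ⟩
        iter (suc L + t) c      ≡⟨ cong (λ z → iter z c) (NP.+-comm (suc L) t) ⟩
        iter (t + suc L) c      ≡⟨ iter-+ t (suc L) c ⟩
        iter t (iter (suc L) c) ≡⟨ cong (iter t) periodic ⟩
        iter t c                ∎
        where open ≡-Reasoning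

      g : Fin n → Fin n
      g x = if onC x then f x else x

      h : Fin n → Fin n
      h x = if onC x then iter L x else x

      g-onC : ∀ x → onC x ≡ true → g x ≡ f x
      g-onC x e rewrite e = refl

      g-offC : ∀ x → onC x ≡ false → g x ≡ x
      g-offC x e rewrite e = refl

      h-onC : ∀ x → onC x ≡ true → h x ≡ iter L x
      h-onC x e rewrite e = refl

      h-offC : ∀ x → onC x ≡ false → h x ≡ x
      h-offC x e rewrite e = refl

      g-closed : ∀ x → X x ≡ true → X (g x) ≡ true
      g-closed x e = bool-cases (onC x)
        (λ i → subst (λ z → X z ≡ true) (esym (g-onC x i)) (f-closed x e))
        (λ i → subst (λ z → X z ≡ true) (esym (g-offC x i)) e)

      h-closed : ∀ x → X x ≡ true → X (h x) ≡ true
      h-closed x e = bool-cases (onC x)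
        (λ i → subst (λ z → X z ≡ true) (esym (h-onC x i)) (iter-closed L x e))
        (λ i → subst (λ z → X z ≡ true) (esym (h-offC x i)) e)

      hg : ∀ x → X x ≡ true → h (g x) ≡ x
      hg x _ = bool-cases (onC x)
        (λ i → trans (cong h (g-onC x i)) (trans (h-onC (f x) (onC-f x i))
                 (trans (iter-f L x) (onC-periodic x i))))
        (λ i → trans (cong h (g-offC x i)) (h-offC x i))

      gh : ∀ x → X x ≡ true → g (h x) ≡ x
      gh x _ = bool-cases (onC x)
        (λ i → trans (cong g (h-onC x i)) (trans (g-onC (iter L x) (onC-iter L x i)) (onC-periodic x i)))
        (λ i → trans (cong g (h-offC x i)) (g-offC x i))

      g-alternating : ∀ x → X x ≡ true → Adj G x (p (g x))
      g-alternating x e = bool-cases (onC x)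
        (λ i → subst (λ z → Adj G x (p z)) (esym (g-onC x i)) (f-alternating x e))
        (λ i → subst (λ z → Adj G x (p z)) (esym (g-offC x i)) (p-adjacent x))

      absurd : ⊥
      absurd = f-moves c X-c (trans (esym (g-onC c (onC-intro 0 c refl)))
        (Rematch.g-identity X X-disjoint g h g-closed h-closed hg gh g-alternating c X-c))

    X-empty : ∀ x₀ → X x₀ ≡ true → ⊥
    X-empty x₀ e with find-cycle x₀ e
    ... | c , L , X-c , periodic = OnCycle.absurd c L X-c periodic

  no-alternating-self-map : (X : Fin n → Bool) → (∀ x → X x ≡ true → X (p x) ≡ false) →
    (f : Fin n → Fin n) → (∀ x → X x ≡ true → X (f x) ≡ true) → (∀ x → X x ≡ true → f x ≢ x) →
    (∀ x → X x ≡ true → Adj G x (p (f x))) → ∀ x → X x ≡ true → ⊥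
  no-alternating-self-map = SelfMap.X-empty

  module Pendant (S : Fin n → Bool) (S-closed : ∀ x → S (p x) ≡ S x) where

    IsPendant : Fin n → Set
    IsPendant u = (S u ≡ true) × (∀ w → S w ≡ true → Adj G u w → w ≡ p u)

    extraNbr : Fin n → Fin n → Bool
    extraNbr u w = S w ∧ adj G u w ∧ not ⌊ w ≟ p u ⌋

    hasExtraNbr : Fin n → Bool
    hasExtraNbr u = anyFin (extraNbr u)

    extraNbr-intro : ∀ {u w} → S w ≡ true → Adj G u w → w ≢ p u → extraNbr u w ≡ true
    extraNbr-intro {u} {w} Sw uw w≢pu =
      ∧-true {S w} Sw (∧-true {adj G u w} uw (⇒not≡true (to-no (w ≟ p u) w≢pu)))

    extraNbr-elim : ∀ {u w} → extraNbr u w ≡ true → (S w ≡ true) × Adj G u w × (w ≢ p u)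
    extraNbr-elim {u} {w} e =
      ∧-true₁ {S w} e , ∧-true₁ {adj G u w} (∧-true₂ {S w} e) ,
      from-no (w ≟ p u) (not≡true⇒ (∧-true₂ {adj G u w} (∧-true₂ {S w} e)))

    no-extra⇒pendant : ∀ u → S u ≡ true → hasExtraNbr u ≡ false → IsPendant u
    no-extra⇒pendant u Su none = Su , only-partner
      where
        only-partner : ∀ w → S w ≡ true → Adj G u w → w ≡ p u
        only-partner w Sw uw with w ≟ p u
        ... | yes eq   = eq
        ... | no w≢pu = ⊥-elim (true-and-false (extraNbr-intro Sw uw w≢pu) (anyFin≡false⇒ (extraNbr u) none w))

    extra-witness : ∀ u → hasExtraNbr u ≡ true → Σ (Fin n) λ w → (S w ≡ true) × Adj G u w × (w ≢ p u)
    extra-witness u e with anyFin-witness (extraNbr u) e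
    ... | w , ew = w , extraNbr-elim ew

    pendant-or-extra : Σ (Fin n) IsPendant ⊎ (∀ u → S u ≡ true → hasExtraNbr u ≡ true)
    pendant-or-extra = bool-cases (anyFin noExtra) found none
      where
        noExtra : Fin n → Bool
        noExtra u = S u ∧ not (hasExtraNbr u)
        found : anyFin noExtra ≡ true → Σ (Fin n) IsPendant ⊎ _
        found e with anyFin-witness noExtra e
        ... | u , eu = inj₁ (u , no-extra⇒pendant u (∧-true₁ eu) (not≡true⇒ (∧-true₂ {S u} eu)))
        none : anyFin noExtra ≡ false → _ ⊎ (∀ u → S u ≡ true → hasExtraNbr u ≡ true)
        none e = inj₂ λ u Su → ¬false⇒true λ f →
          true-and-false (∧-true Su (⇒not≡true f)) (anyFin≡false⇒ noExtra e u)

    extra : Fin n → Fin n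
    extra u = search (extraNbr u) u

    extra-ok : ∀ u → hasExtraNbr u ≡ true → (S (extra u) ≡ true) × Adj G u (extra u) × (extra u ≢ p u)
    extra-ok u e with extra-witness u e
    ... | w , Sw , uw , w≢pu = extraNbr-elim (search-ok (extraNbr u) u w (extraNbr-intro Sw uw w≢pu))

    -- If every vertex of S had an extra neighbour,
    -- consider X = S ∖ T (disjoint from p X since T's complement is independent).
    -- If X is empty, any x ∈ S and its extra neighbour w give x ~ w and, inside
    -- the clique, p x ~ p w: an alternating square.  Otherwise u ↦ p (extra u)
    -- is an alternating self-map of X.
    module Split (T : Fin n → Bool)
                 (clique : ∀ u v → T u ≡ true → T v ≡ true → u ≢ v → Adj G u v)
                 (independent : ∀ u v → T u ≡ false → T v ≡ false → ¬ Adj G u v)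
                 (allExtra : ∀ u → S u ≡ true → hasExtraNbr u ≡ true) where

      partner-in-T : ∀ u → T u ≡ false → T (p u) ≡ true
      partner-in-T u e = ¬false⇒true (λ e' → independent u (p u) e e' (p-adjacent u))

      partners-≢ : ∀ {u w} → Adj G u w → p u ≢ p w
      partners-≢ uw eq = adj⇒≢ uw (p-injective eq)

      X : Fin n → Bool
      X u = S u ∧ not (T u)

      X-disjoint : ∀ u → X u ≡ true → X (p u) ≡ false
      X-disjoint u e = ¬true⇒false (λ e' → true-and-false (partner-in-T u (not≡true⇒ (∧-true₂ {S u} e)))
                                                          (not≡true⇒ (∧-true₂ {S (p u)} e')))

      X-nonempty : ∀ x → S x ≡ true → anyFin X ≡ false → ⊥
      X-nonempty x Sx e = partners-nonadjacent xw w≢px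
                            (clique (p x) (p w) (inT (p x) (trans (S-closed x) Sx))
                                    (inT (p w) (trans (S-closed w) Sw)) (partners-≢ xw))
        where
          inT : ∀ u → S u ≡ true → T u ≡ true
          inT u Su = ¬false⇒true (λ tf → true-and-false (∧-true Su (⇒not≡true tf)) (anyFin≡false⇒ X e u))
          w : Fin n
          w = extra x
          Sw : S w ≡ true
          Sw = proj₁ (extra-ok x (allExtra x Sx))
          xw : Adj G x w
          xw = proj₁ (proj₂ (extra-ok x (allExtra x Sx)))
          w≢px : w ≢ p x
          w≢px = proj₂ (proj₂ (extra-ok x (allExtra x Sx)))

      f : Fin n → Fin n
      f u = p (extra u)

      module _ (u : Fin n) (Xu : X u ≡ true) where
        private
          Su : S u ≡ true
          Su = ∧-true₁ {S u} Xu
          w : Fin n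
          w = extra u
          Sw : S w ≡ true
          Sw = proj₁ (extra-ok u (allExtra u Su))
          uw : Adj G u w
          uw = proj₁ (proj₂ (extra-ok u (allExtra u Su)))
          w≢pu : w ≢ p u
          w≢pu = proj₂ (proj₂ (extra-ok u (allExtra u Su)))
          Tu : T u ≡ false
          Tu = not≡true⇒ (∧-true₂ {S u} Xu)

        f-closed : X (f u) ≡ true
        f-closed = ∧-true (trans (S-closed w) Sw) (⇒not≡true pw∉T)
          where
            pw∉T : T (p w) ≡ false
            pw∉T = ¬true⇒false (λ e → partners-nonadjacent uw w≢pu
                      (clique (p u) (p w) (partner-in-T u Tu) e (partners-≢ uw)))

        f-moves : f u ≢ u
        f-moves eq = w≢pu (trans (esym (p-involutive w)) (cong p eq))

        f-alternating : Adj G u (p (f u))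
        f-alternating = subst (Adj G u) (esym (p-involutive w)) uw

      absurd : ∀ x → S x ≡ true → ⊥
      absurd x Sx = bool-cases (anyFin X)
        (λ e → let (x₀ , ex) = anyFin-witness X e
               in no-alternating-self-map X X-disjoint f f-closed f-moves f-alternating x₀ ex)
        (X-nonempty x Sx)

    split-pendant : IsSplit G → ∀ x → S x ≡ true → Σ (Fin n) IsPendant
    split-pendant (T , clique , independent) x Sx with pendant-or-extra
    ... | inj₁ pendant  = pendant
    ... | inj₂ allExtra = ⊥-elim (Split.absurd T clique independent allExtra x Sx)

    -- Domination is transitive and irreflexive, so following dominators
    -- reaches an undominated y ∈ S.  For undominated y, every extra neighbour
    -- w of y satisfies y ~ p w, and y and p y cannot both have extra
    -- neighbours (otherwise an induced P4 appears); so y or p y is pendant.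
    module Cograph (cograph : IsCograph G) where

      adj-stable : ∀ {x y} → ¬ ¬ Adj G x y → Adj G x y
      adj-stable {x} {y} k = ¬false⇒true (λ e → k (false⇒¬true e))

      no-P4 : ∀ {a b c d} → Adj G a b → Adj G b c → Adj G c d →
        ¬ Adj G a c → ¬ Adj G b d → ¬ Adj G a d → ⊥
      no-P4 {a} {b} {c} {d} ab bc cd a≁c b≁d a≁d =
        cograph (a , b , c , d , adj⇒≢ ab ,
                 (λ eq → a≁d (subst (λ z → Adj G z d) (esym eq) cd)) ,
                 (λ eq → a≁c (adj-sym (subst (Adj G c) (esym eq) cd))) ,
                 adj⇒≢ bc ,
                 (λ eq → a≁d (subst (Adj G a) eq ab)) ,
                 adj⇒≢ cd ,
                 ab , bc , cd , a≁c , b≁d , a≁d)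

      Dominates : Fin n → Fin n → Set
      Dominates z y = Adj G z y × Adj G z (p y)

      dominates-trans : ∀ {z y z'} → Dominates z y → Dominates z' z → Dominates z' y
      dominates-trans {z} {y} {z'} (zy , zpy) (z'z , z'pz) =
        bool-cases (adj G z' y) (λ z'y → z'y , adj-stable (crossed z'y))
                                (λ e → ⊥-elim (nonadjacent (false⇒¬true e)))
        where
          pz'≁z : ¬ Adj G (p z') z
          pz'≁z = no-alternating-square′ z' z (adj⇒≢ z'z) z'pz
          pz'≁pz : ¬ Adj G (p z') (p z)
          pz'≁pz = no-alternating-square z' z (adj⇒≢ z'pz) z'z
          pz≁y : ¬ Adj G (p z) y
          pz≁y = no-alternating-square′ z y (adj⇒≢ zy) zpy
          -- if z' misses a neighbour t of z, then p z' ~ t (else p z' z' z t is a P4)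
          partner-takes-over : ∀ {t} → Adj G z t → ¬ Adj G z' t → Adj G (p z') t
          partner-takes-over zt z'≁t =
            adj-stable (λ pz'≁t → no-P4 (adj-sym (p-adjacent z')) z'z zt pz'≁z z'≁t pz'≁t)
          crossed : Adj G z' y → ¬ ¬ Adj G z' (p y)
          crossed z'y z'≁py = no-alternating-square z' y z'≢py z'y (partner-takes-over zpy z'≁py)
            where
              z'≢py : z' ≢ p y
              z'≢py eq = pz'≁z (subst (λ t → Adj G t z) (esym (trans (cong p eq) (p-involutive y))) (adj-sym zy))
          nonadjacent : ¬ Adj G z' y → ⊥
          nonadjacent z'≁y = bool-cases (adj G z' (p y)) square
            (λ _ → no-P4 (adj-sym z'pz) (p-adjacent z') pz'y (nonadj-sym pz'≁pz) z'≁y pz≁y)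
            where
              pz'y : Adj G (p z') y
              pz'y = partner-takes-over zy z'≁y
              square : Adj G z' (p y) → ⊥
              square z'py = no-alternating-square′ z' y
                (λ eq → pz'≁z (subst (λ t → Adj G (p t) z) (esym eq) (adj-sym zpy))) z'py pz'y

      dominator : Fin n → Fin n → Bool
      dominator y z = S z ∧ adj G z y ∧ adj G z (p y)

      dominator-elim : ∀ {y z} → dominator y z ≡ true → (S z ≡ true) × Dominates z y
      dominator-elim {y} {z} e = ∧-true₁ {S z} e , ∧-true₁ {adj G z y} (∧-true₂ {S z} e) ,
                                 ∧-true₂ {adj G z y} (∧-true₂ {S z} e)

      dominator-intro : ∀ {y z} → S z ≡ true → Dominates z y → dominator y z ≡ true
      dominator-intro {y} {z} Sz (zy , zpy) = ∧-true {S z} Sz (∧-true {adj G z y} zy zpy)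

      Undominated : Fin n → Set
      Undominated y = ∀ z → S z ≡ true → ¬ Dominates z y

      -- A dominator z of y has strictly fewer dominators: they all dominate y,
      -- and z dominates y but not itself.
      fewer-dominators : ∀ {y z} → dominator y z ≡ true → count (dominator z) < count (dominator y)
      fewer-dominators {y} {z} e = count-strict (dominator z) (dominator y) inherit z e not-self
        where
          inherit : ∀ w → dominator z w ≡ true → dominator y w ≡ true
          inherit w e' = let (Sw , wz) = dominator-elim e'
                         in dominator-intro Sw (dominates-trans (proj₂ (dominator-elim e)) wz)
          not-self : dominator z z ≡ false
          not-self = ¬true⇒false (λ t → adj⇒≢ (proj₁ (proj₂ (dominator-elim t))) refl)

      descend : ∀ m y → S y ≡ true → count (dominator y) < m →
        Σ (Fin n) λ y' → (S y' ≡ true) × Undominated y'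
      descend (suc m) y Sy lt = bool-cases (anyFin (dominator y)) step stop
        where
          step : anyFin (dominator y) ≡ true → Σ (Fin n) λ y' → (S y' ≡ true) × Undominated y'
          step e with anyFin-witness (dominator y) e
          ... | z , ez = descend m z (proj₁ (dominator-elim ez))
                           (NP.<-≤-trans (fewer-dominators ez) (ℕ.s≤s⁻¹ lt))
          stop : anyFin (dominator y) ≡ false → Σ (Fin n) λ y' → (S y' ≡ true) × Undominated y'
          stop e = y , Sy , λ z Sz zy → true-and-false (dominator-intro Sz zy) (anyFin≡false⇒ (dominator y) e z)

      -- An extra neighbour w of an undominated y is crossed: y ~ p w
      -- (else p y y w p w is a P4).
      extra-nbr-crossed : ∀ {y w} → Undominated y → S w ≡ true → Adj G y w → w ≢ p y → Adj G y (p w)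
      extra-nbr-crossed {y} {w} ud Sw yw w≢py = adj-stable λ y≁pw →
        no-P4 (adj-sym (p-adjacent y)) yw (p-adjacent w)
              (λ k → ud w Sw (adj-sym yw , adj-sym k)) y≁pw (partners-nonadjacent yw w≢py)

      module Clash {y w w'} (ud : Undominated y)
                   (Sw : S w ≡ true) (yw : Adj G y w) (w≢py : w ≢ p y)
                   (Sw' : S w' ≡ true) (py-w' : Adj G (p y) w') (w'≢ppy : w' ≢ p (p y)) where

        y-pw : Adj G y (p w)
        y-pw = extra-nbr-crossed ud Sw yw w≢py

        py≁w : ¬ Adj G (p y) w
        py≁w k = ud w Sw (adj-sym yw , adj-sym k)

        y≁w' : ¬ Adj G y w'
        y≁w' k = ud w' Sw' (adj-sym k , adj-sym py-w')

        py≁pw : ¬ Adj G (p y) (p w)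
        py≁pw = partners-nonadjacent yw w≢py

        pw'≁y : ¬ Adj G (p w') y
        pw'≁y k = partners-nonadjacent py-w' w'≢ppy
                    (subst (λ t → Adj G t (p w')) (esym (p-involutive y)) (adj-sym k))

        -- w ~ w', else w y p y w' is a P4
        w-w' : Adj G w w'
        w-w' = adj-stable (no-P4 (adj-sym yw) (p-adjacent y) py-w' (nonadj-sym py≁w) y≁w')

        -- w ≁ p w': otherwise p w ≁ w' (square) and p w w w' p y is a P4
        w≁pw' : ¬ Adj G w (p w')
        w≁pw' w-pw' = no-P4 (adj-sym (p-adjacent w)) w-w' (adj-sym py-w')
                            (no-alternating-square′ w w' (adj⇒≢ w-w') w-pw')
                            (nonadj-sym py≁w) (nonadj-sym py≁pw)

        -- p w ≁ w': otherwise p w' ≁ w (square) and p w' w' w y is a P4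
        pw≁w' : ¬ Adj G (p w) w'
        pw≁w' pw-w' = no-P4 (adj-sym (p-adjacent w')) (adj-sym w-w') (adj-sym yw)
                            (no-alternating-square′ w' w (adj⇒≢ (adj-sym w-w')) (adj-sym pw-w'))
                            (nonadj-sym y≁w') pw'≁y

        -- so p w w w' p w' is a P4
        absurd : ⊥
        absurd = no-P4 (adj-sym (p-adjacent w)) w-w' (p-adjacent w') pw≁w' w≁pw'
                       (partners-nonadjacent w-w' (λ eq → y≁w' (subst (Adj G y) (esym eq) y-pw)))

      undominated⇒pendant : ∀ y → S y ≡ true → Undominated y → Σ (Fin n) IsPendant
      undominated⇒pendant y Sy ud =
        bool-cases (hasExtraNbr y)
          (λ e → bool-cases (hasExtraNbr (p y)) (λ e' → ⊥-elim (clash e e'))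
                            (λ e' → p y , no-extra⇒pendant (p y) (trans (S-closed y) Sy) e'))
          (λ e → y , no-extra⇒pendant y Sy e)
        where
          clash : hasExtraNbr y ≡ true → hasExtraNbr (p y) ≡ true → ⊥
          clash e e' = let (w , Sw , yw , w≢py) = extra-witness y e
                           (w' , Sw' , py-w' , w'≢ppy) = extra-witness (p y) e'
                       in Clash.absurd ud Sw yw w≢py Sw' py-w' w'≢ppy

      cograph-pendant : ∀ x → S x ≡ true → Σ (Fin n) IsPendant
      cograph-pendant x Sx =
        let (y , Sy , ud) = descend (suc (count (dominator x))) x Sx (NP.n<1+n (count (dominator x)))
        in undominated⇒pendant y Sy ud

  pendant-lemma : IsCograph G ⊎ IsSplit G → (S : Fin n → Bool) (S-closed : ∀ x → S (p x) ≡ S x) →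
    ∀ x → S x ≡ true → Σ (Fin n) (Pendant.IsPendant S S-closed)
  pendant-lemma (inj₁ cograph) S S-closed = Pendant.Cograph.cograph-pendant S S-closed cograph
  pendant-lemma (inj₂ split)   S S-closed = Pendant.split-pendant S S-closed split

module ClosedNbhd {n : ℕ} (G : Graph n) where
  open Matchings G

  inN : Fin n → Fin n → Bool
  inN = inClosedNbhd G

  inN-self : ∀ x → inN x x ≡ true
  inN-self x = ∨-trueˡ (to-yes (x ≟ x) refl)

  inN-adj : ∀ {x y} → Adj G x y → inN x y ≡ true
  inN-adj a = ∨-trueʳ a

  inN-cases : ∀ x y → inN x y ≡ true → (x ≡ y) ⊎ Adj G x y
  inN-cases x y e with ∨-true e
  ... | inj₁ e₁ = inj₁ (from-yes (x ≟ y) e₁)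
  ... | inj₂ e₂ = inj₂ e₂

  count-remove : (S : Fin n → Bool) (x : Fin n) → S x ≡ true →
    count (λ w → adj G x w ∧ S w) ≡ 1 →
    count S ≡ 2 + count (λ w → S w ∧ not (inN x w))
  count-remove S x Sx one = begin
    count S
      ≡⟨ count-split S (inN x) ⟩
    count (λ w → S w ∧ inN x w) + rest
      ≡⟨ cong (_+ rest) (count-split (λ w → S w ∧ inN x w) (λ w → ⌊ x ≟ w ⌋)) ⟩
    (count (λ w → (S w ∧ inN x w) ∧ ⌊ x ≟ w ⌋) + others) + rest
      ≡⟨ cong (λ c → (c + others) + rest) itself ⟩
    (1 + others) + rest
      ≡⟨ cong (λ c → (1 + c) + rest) (trans (count-cong neighbours) one) ⟩
    2 + rest
      ∎
    where
      open ≡-Reasoning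
      rest : ℕ
      rest = count (λ w → S w ∧ not (inN x w))
      others : ℕ
      others = count (λ w → (S w ∧ inN x w) ∧ not ⌊ x ≟ w ⌋)
      itself : count (λ w → (S w ∧ inN x w) ∧ ⌊ x ≟ w ⌋) ≡ 1
      itself = count-single _ x (∧-true {S x ∧ inN x x} (∧-true {S x} Sx (inN-self x)) (to-yes (x ≟ x) refl))
                 (λ w e → esym (from-yes (x ≟ w) (∧-true₂ {S w ∧ inN x w} e)))
      neighbours : ∀ w → (S w ∧ inN x w) ∧ not ⌊ x ≟ w ⌋ ≡ adj G x w ∧ S w
      neighbours w with x ≟ w
      ... | yes refl rewrite irrefl G x = BP.∧-zeroʳ (S x ∧ true)
      ... | no _ = trans (BP.∧-identityʳ _) (BP.∧-comm (S w) (adj G x w))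

-- The vertex sets of the graphs Gᵢ for a sequence u : Fin k → Fin n, indexed
-- by a natural number m: R m w holds iff w ∉ N[u j] for all j < m, so that
-- R (toℕ i) is exactly inGi G u i.

module Remaining {n k : ℕ} (G : Graph n) (u : Fin k → Fin n) where
  open ClosedNbhd G

  removedBy : ℕ → Fin n → Fin k → Bool
  removedBy m w j = ⌊ suc (toℕ j) ℕ.≤? m ⌋ ∧ inN (u j) w

  R : ℕ → Fin n → Bool
  R m w = not (anyFin (removedBy m w))

  R-zero : ∀ w → R 0 w ≡ true
  R-zero w = ⇒not≡true (anyFin-none (removedBy 0 w) none)
    where
      none : ∀ (j : Fin k) → removedBy 0 w j ≡ false
      none j rewrite to-no (suc (toℕ j) ℕ.≤? 0) (λ ()) = refl

  R-avoids : ∀ j m w → toℕ j < m → R m w ≡ true → inN (u j) w ≡ false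
  R-avoids j m w lt e = ¬true⇒false (λ t → true-and-false
    (anyFin-intro (removedBy m w) j (∧-true (to-yes (suc (toℕ j) ℕ.≤? m) lt) t))
    (not≡true⇒ e))

  R-intro : ∀ m w → (∀ j → toℕ j < m → inN (u j) w ≡ false) → R m w ≡ true
  R-intro m w avoids = ⇒not≡true (anyFin-none (removedBy m w) (λ j → ¬true⇒false (λ e →
    true-and-false (∧-true₂ {⌊ suc (toℕ j) ℕ.≤? m ⌋} e)
                   (avoids j (from-yes (suc (toℕ j) ℕ.≤? m) (∧-true₁ e))))))

  R-step : ∀ i w → R (suc (toℕ i)) w ≡ R (toℕ i) w ∧ not (inN (u i) w)
  R-step i w = bool-ext
    (λ e → ∧-true (R-intro (toℕ i) w (λ j lt → R-avoids j (suc (toℕ i)) w (NP.m≤n⇒m≤1+n lt) e))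
                  (⇒not≡true (R-avoids i (suc (toℕ i)) w (NP.n<1+n _) e)))
    (λ e → R-intro (suc (toℕ i)) w
             (λ j lt → earlier j lt (∧-true₁ e) (not≡true⇒ (∧-true₂ {R (toℕ i) w} e))))
    where
      earlier : ∀ j → toℕ j < suc (toℕ i) → R (toℕ i) w ≡ true → inN (u i) w ≡ false →
        inN (u j) w ≡ false
      earlier j lt r ni with NP.m≤n⇒m<n∨m≡n (ℕ.s≤s⁻¹ lt)
      ... | inj₁ lt' = R-avoids j (toℕ i) w lt' r
      ... | inj₂ eq rewrite FP.toℕ-injective eq = ni

  R-removed-at : ∀ m w → R m w ≡ false →
    Σ (Fin k) λ j → (toℕ j < m) × (R (toℕ j) w ≡ true) × (inN (u j) w ≡ true)
  R-removed-at zero w e = ⊥-elim (true-and-false (R-zero w) e)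
  R-removed-at (suc m) w e = bool-cases (R m w) now before
    where
      before : R m w ≡ false → _
      before e' with R-removed-at m w e'
      ... | j , lt , r , i = j , NP.m≤n⇒m≤1+n lt , r , i
      now : R m w ≡ true → _
      now e' with anyFin-witness (removedBy (suc m) w) (not≡false⇒ e)
      ... | j , ej with NP.m≤n⇒m<n∨m≡n (ℕ.s≤s⁻¹ (from-yes (suc (toℕ j) ℕ.≤? suc m) (∧-true₁ ej)))
      ...   | inj₁ lt = ⊥-elim (true-and-false (∧-true₂ {⌊ suc (toℕ j) ℕ.≤? suc m ⌋} ej)
                                               (R-avoids j m w lt e'))
      ...   | inj₂ eq = j , subst (_< suc m) (esym eq) (NP.n<1+n m) , subst (λ z → R z w ≡ true) (esym eq) e' ,
                        ∧-true₂ {⌊ suc (toℕ j) ℕ.≤? suc m ⌋} ej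

  R-count : ∀ i → R (toℕ i) (u i) ≡ true → count (λ w → adj G (u i) w ∧ R (toℕ i) w) ≡ 1 →
    count (R (toℕ i)) ≡ 2 + count (R (suc (toℕ i)))
  R-count i r one = trans (count-remove (R (toℕ i)) (u i) r one)
                          (cong (2 +_) (count-cong (λ w → esym (R-step i w))))

count-shift : ∀ a b c m → a ≡ 2 + b → a + 2 * c ≡ m → b + 2 * suc c ≡ m
count-shift a b c m a≡ a+ rewrite NP.*-suc 2 c | esym (NP.+-assoc b 2 (2 * c)) | NP.+-comm b 2 =
  trans (cong (_+ 2 * c) (esym a≡)) a+

module ForcingToUnique {n k : ℕ} (G : Graph n) (u : Fin k → Fin n) (forces : Forces G u) where
  open Matchings G
  open ClosedNbhd G
  open Remaining G u

  u-injective : ∀ {i j} → u i ≡ u j → i ≡ j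
  u-injective = proj₁ forces

  u-in-G : ∀ i → R (toℕ i) (u i) ≡ true
  u-in-G i = proj₁ (proj₂ (proj₂ forces) i)

  nbrInG : Fin k → Fin n → Bool
  nbrInG j w = adj G (u j) w ∧ R (toℕ j) w

  degree-one : ∀ i → count (nbrInG i) ≡ 1
  degree-one i = proj₂ (proj₂ (proj₂ forces) i)

  v : Fin k → Fin n
  v j = search (nbrInG j) (u j)

  v-ok : ∀ j → nbrInG j (v j) ≡ true
  v-ok j = let (w , e) = count-witness (nbrInG j) (degree-one j) in search-ok (nbrInG j) (u j) w e

  u-v : ∀ j → Adj G (u j) (v j)
  u-v j = ∧-true₁ {adj G (u j) (v j)} (v-ok j)

  v-in-G : ∀ j → R (toℕ j) (v j) ≡ true
  v-in-G j = ∧-true₂ {adj G (u j) (v j)} (v-ok j)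

  v-unique : ∀ j w → Adj G (u j) w → R (toℕ j) w ≡ true → w ≡ v j
  v-unique j w a r = count≡1⇒unique (nbrInG j) (degree-one j) w (v j) (∧-true {adj G (u j) w} a r) (v-ok j)

  remaining-count : ∀ m → m ≤ k → count (R m) + 2 * m ≡ n
  remaining-count zero    _  = trans (NP.+-identityʳ _) (trans (count-cong R-zero) (count-const-true n))
  remaining-count (suc m) lt = count-shift _ _ m n shrink (remaining-count m (NP.<⇒≤ lt))
    where
      i = F.fromℕ< lt
      shrink : count (R m) ≡ 2 + count (R (suc m))
      shrink = subst (λ z → count (R z) ≡ 2 + count (R (suc z))) (FP.toℕ-fromℕ< lt)
                     (R-count i (u-in-G i) (degree-one i))

  G-k-empty : count (R k) ≡ 0
  G-k-empty = NP.+-cancelʳ-≡ (2 * k) (count (R k)) 0 (trans (remaining-count k NP.≤-refl) (proj₁ (proj₂ forces)))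

  covered : ∀ w → Σ (Fin k) λ j → (w ≡ u j) ⊎ (w ≡ v j)
  covered w with R-removed-at k w (count≡0⇒false (R k) G-k-empty w)
  ... | j , _ , r , i with inN-cases (u j) w i
  ...   | inj₁ e = j , inj₁ (esym e)
  ...   | inj₂ a = j , inj₂ (v-unique j w a r)

  -- A vertex of Gⱼ is outside N[uᵢ] for i < j; this separates the uᵢ and vᵢ.
  u≢v : ∀ i j → u i ≢ v j
  u≢v i j e with FP.<-cmp i j
  ... | tri< lt _ _ = true-and-false (subst (λ z → inN (u i) z ≡ true) e (inN-self (u i)))
                                     (R-avoids i (toℕ j) (v j) lt (v-in-G j))
  ... | tri≈ _ refl _ = adj⇒≢ (u-v i) e
  ... | tri> _ _ gt = true-and-false (subst (λ z → inN (u j) z ≡ true) (esym e) (inN-adj (u-v j)))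
                                     (R-avoids j (toℕ i) (u i) gt (u-in-G i))

  v-injective : ∀ {i j} → v i ≡ v j → i ≡ j
  v-injective {i} {j} e with FP.<-cmp i j
  ... | tri< lt _ _ = ⊥-elim (true-and-false (subst (λ z → inN (u i) z ≡ true) e (inN-adj (u-v i)))
                                              (R-avoids i (toℕ j) (v j) lt (v-in-G j)))
  ... | tri≈ _ eq _ = eq
  ... | tri> _ _ gt = ⊥-elim (true-and-false (subst (λ z → inN (u j) z ≡ true) (esym e) (inN-adj (u-v j)))
                                              (R-avoids j (toℕ i) (v i) gt (v-in-G i)))

  pairing : Fin n → Fin n
  pairing w with covered w
  ... | j , inj₁ _ = v j
  ... | j , inj₂ _ = u j

  pairing-u : ∀ j → pairing (u j) ≡ v j
  pairing-u j with covered (u j)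
  ... | j' , inj₁ e = cong v (u-injective (esym e))
  ... | j' , inj₂ e = ⊥-elim (u≢v j j' e)

  pairing-v : ∀ j → pairing (v j) ≡ u j
  pairing-v j with covered (v j)
  ... | j' , inj₁ e = ⊥-elim (u≢v j' j (esym e))
  ... | j' , inj₂ e = cong u (v-injective (esym e))

  by-cover : (C : Fin n → Set) → (∀ j → C (u j)) → (∀ j → C (v j)) → ∀ w → C w
  by-cover C cu cv w with covered w
  ... | j , inj₁ e = subst C (esym e) (cu j)
  ... | j , inj₂ e = subst C (esym e) (cv j)

  pairing-involutive : ∀ w → pairing (pairing w) ≡ w
  pairing-involutive = by-cover (λ w → pairing (pairing w) ≡ w)
    (λ j → trans (cong pairing (pairing-u j)) (pairing-v j))
    (λ j → trans (cong pairing (pairing-v j)) (pairing-u j))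

  pairing-adjacent : ∀ w → Adj G w (pairing w)
  pairing-adjacent = by-cover (λ w → Adj G w (pairing w))
    (λ j → subst (Adj G (u j)) (esym (pairing-u j)) (u-v j))
    (λ j → subst (Adj G (v j)) (esym (pairing-v j)) (adj-sym (u-v j)))

  -- Every perfect matching P pairs uᵢ with vᵢ, by strong induction on i: the
  -- partner y of uᵢ lies in Gᵢ, because a vertex removed earlier is some uⱼ
  -- or vⱼ with j < i, and those are already matched with each other.
  module Forced (P : PerfectMatching G) where
    forced-below : ∀ m i → toℕ i < m → partner P (u i) ≡ v i
    forced-below (suc m) i lt with NP.m≤n⇒m<n∨m≡n (ℕ.s≤s⁻¹ lt)
    ... | inj₁ lt' = forced-below m i lt'
    ... | inj₂ i≡m = v-unique i y (partner-adjacent P (u i)) y-in-G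
      where
        y = partner P (u i)
        earlier : ∀ j → toℕ j < toℕ i → partner P (u j) ≡ v j
        earlier j l = forced-below m j (subst (toℕ j <_) i≡m l)
        removed-earlier : (Σ (Fin k) λ j → (toℕ j < toℕ i) × (R (toℕ j) y ≡ true) × (inN (u j) y ≡ true)) →
          ⊥
        removed-earlier (j , l , r , inn) with inN-cases (u j) y inn
        ... | inj₁ uj≡y = u≢v i j (trans (esym (partner-involutive P (u i)))
                                          (trans (cong (partner P) (esym uj≡y)) (earlier j l)))
        ... | inj₂ a = NP.<-irrefl (cong toℕ (esym (u-injective (begin
                u i                   ≡⟨ esym (partner-involutive P (u i)) ⟩
                partner P y           ≡⟨ cong (partner P) (trans (v-unique j y a r) (esym (earlier j l))) ⟩
                partner P (partner P (u j)) ≡⟨ partner-involutive P (u j) ⟩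
                u j                   ∎)))) l
          where open ≡-Reasoning
        y-in-G : R (toℕ i) y ≡ true
        y-in-G = ¬false⇒true (λ e → removed-earlier (R-removed-at (toℕ i) y e))

    forced-u : ∀ j → partner P (u j) ≡ v j
    forced-u j = forced-below (suc (toℕ j)) j (NP.n<1+n _)

    forced : ∀ w → partner P w ≡ pairing w
    forced = by-cover (λ w → partner P w ≡ pairing w)
      (λ j → trans (forced-u j) (esym (pairing-u j)))
      (λ j → trans (cong (partner P) (esym (forced-u j)))
                   (trans (partner-involutive P (u j)) (esym (pairing-v j))))

  unique-matching : HasUniquePM G
  unique-matching = involutionMatching pairing pairing-involutive pairing-adjacent ,
    λ P Q → same-partners⇒same-edges P Q (λ x → trans (Forced.forced P x) (esym (Forced.forced Q x)))

-- Starting from S₀ = V(G), repeatedly pick a vertex Uᵢ of degree one in Sᵢ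
-- (a pendant vertex) and let Sᵢ₊₁ = Sᵢ - N[Uᵢ]; each Sᵢ stays p-closed, loses
-- exactly two vertices per step, and coincides with the vertex set of Gᵢ.

module UniqueToForcing {n : ℕ} (G : Graph n) (class : IsCograph G ⊎ IsSplit G) (P₀ : PerfectMatching G)
          (unique : Matchings.AtMostOneMatching G) (default : Fin n) where
  open Matchings G
  open ClosedNbhd G
  open UniqueMatching G P₀ unique

  nbrsIn : (Fin n → Bool) → Fin n → Fin n → Bool
  nbrsIn S x w = adj G x w ∧ S w

  degreeOne : (Fin n → Bool) → Fin n → Bool
  degreeOne S x = S x ∧ ⌊ count (nbrsIn S x) ℕ.≟ 1 ⌋

  degreeOne-in : ∀ S x → degreeOne S x ≡ true → S x ≡ true
  degreeOne-in S x e = ∧-true₁ {S x} e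

  degreeOne-count : ∀ S x → degreeOne S x ≡ true → count (nbrsIn S x) ≡ 1
  degreeOne-count S x e = from-yes (count (nbrsIn S x) ℕ.≟ 1) (∧-true₂ {S x} e)

  degreeOne-exists : ∀ S → (∀ x → S (p x) ≡ S x) → ∀ x → S x ≡ true →
    Σ (Fin n) λ y → degreeOne S y ≡ true
  degreeOne-exists S S-closed x Sx with pendant-lemma class S S-closed x Sx
  ... | y , Sy , only-partner = y , ∧-true {S y} Sy (to-yes (count (nbrsIn S y) ℕ.≟ 1)
          (count-single _ (p y) (∧-true {adj G y (p y)} (p-adjacent y) (trans (S-closed y) Sy))
             (λ w e → only-partner w (∧-true₂ {adj G y w} e) (∧-true₁ {adj G y w} e))))

  -- If u has degree one in the p-closed set S, then N[u] ∩ S = {u, p u}, so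
  -- S - N[u] is again p-closed.
  deletion-keeps-closed : ∀ S u → (∀ x → S (p x) ≡ S x) → degreeOne S u ≡ true →
    ∀ x → S x ≡ true → inN u (p x) ≡ inN u x
  deletion-keeps-closed S u S-closed deg x Sx with x ≟ u | x ≟ p u
  ... | yes refl | _        = trans (inN-adj (p-adjacent x)) (esym (inN-self x))
  ... | no _     | yes refl = trans (cong (inN u) (p-involutive u)) (trans (inN-self u) (esym (inN-adj (p-adjacent u))))
  ... | no x≢u   | no x≢pu  =
    trans (outside (p x) px≢u px≢pu (trans (S-closed x) Sx)) (esym (outside x x≢u x≢pu Sx))
    where
      only-partner : ∀ w → nbrsIn S u w ≡ true → w ≡ p u
      only-partner w e = count≡1⇒unique _ (degreeOne-count S u deg) w (p u) e
                           (∧-true {adj G u (p u)} (p-adjacent u) (trans (S-closed u) (degreeOne-in S u deg)))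
      outside : ∀ y → y ≢ u → y ≢ p u → S y ≡ true → inN u y ≡ false
      outside y y≢u y≢pu Sy = ¬true⇒false λ t →
        [ (λ e → y≢u (esym e)) , (λ a → y≢pu (only-partner y (∧-true {adj G u y} a Sy))) ] (inN-cases u y t)
      px≢u : p x ≢ u
      px≢u e = x≢pu (trans (esym (p-involutive x)) (cong p e))
      px≢pu : p x ≢ p u
      px≢pu e = x≢u (p-injective e)

  S : ℕ → Fin n → Bool
  U : ℕ → Fin n
  S zero    w = true
  S (suc i) w = S i w ∧ not (inN (U i) w)
  U i = search (degreeOne (S i)) default

  mutual
    S-closed : ∀ i x → S i (p x) ≡ S i x
    S-closed zero    x = refl
    S-closed (suc i) x rewrite S-closed i x with S i x in e
    ... | false = refl
    ... | true  = cong not (deletion-keeps-closed (S i) (U i) (S-closed i) (U-ok i x e) x e)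

    U-ok : ∀ i x → S i x ≡ true → degreeOne (S i) (U i) ≡ true
    U-ok i x e = let (y , deg) = degreeOne-exists (S i) (S-closed i) x e
                 in search-ok (degreeOne (S i)) default y deg

  shrink : ∀ i x → S i x ≡ true → count (S i) ≡ 2 + count (S (suc i))
  shrink i x e = count-remove (S i) (U i) (degreeOne-in _ _ (U-ok i x e)) (degreeOne-count _ _ (U-ok i x e))

  exhaust : ∀ c i → count (S i) ≡ c → Σ ℕ λ d → (count (S (d + i)) ≡ 0) × (c ≡ 2 * d) ×
    (∀ j → j < d → Σ (Fin n) λ x → S (j + i) x ≡ true)
  exhaust zero i e = 0 , e , refl , (λ j ())
  exhaust (suc c) i e with count-witness (S i) e
  ... | x , Sx with trans (esym e) (shrink i x Sx)
  exhaust (suc zero)    i e | x , Sx | ()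
  exhaust (suc (suc c)) i e | x , Sx | e₂ with exhaust c (suc i) (esym (NP.suc-injective (NP.suc-injective e₂)))
  ... | d , empty , c≡ , nonempty =
    suc d , subst (λ t → count (S t) ≡ 0) (NP.+-suc d i) empty ,
    trans (cong (λ t → suc (suc t)) c≡) (esym (NP.*-suc 2 d)) , nonempty′
    where
      nonempty′ : ∀ j → j < suc d → Σ (Fin n) λ x → S (j + i) x ≡ true
      nonempty′ zero    _  = x , Sx
      nonempty′ (suc j) lt = let (y , ey) = nonempty j (ℕ.s≤s⁻¹ lt)
                             in y , subst (λ t → S t y ≡ true) (NP.+-suc j i) ey

  run : Σ ℕ λ d → (count (S (d + 0)) ≡ 0) × (n ≡ 2 * d) ×
                  (∀ j → j < d → Σ (Fin n) λ x → S (j + 0) x ≡ true)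
  run = exhaust n 0 (count-const-true n)

  k : ℕ
  k = proj₁ run

  n≡2k : n ≡ 2 * k
  n≡2k = proj₁ (proj₂ (proj₂ run))

  U-ok′ : ∀ j → j < k → degreeOne (S j) (U j) ≡ true
  U-ok′ j lt = let (x , ex) = proj₂ (proj₂ (proj₂ run)) j lt
               in U-ok j x (subst (λ t → S t x ≡ true) (NP.+-identityʳ j) ex)

  u : Fin k → Fin n
  u i = U (toℕ i)

  open Remaining G u

  S≡R : ∀ m → m ≤ k → ∀ w → S m w ≡ R m w
  S≡R zero    _  w = esym (R-zero w)
  S≡R (suc m) lt w = trans (cong (_∧ not (inN (U m) w)) (S≡R m (NP.<⇒≤ lt) w)) (esym step)
    where
      step : R (suc m) w ≡ R m w ∧ not (inN (U m) w)
      step = subst (λ z → R (suc z) w ≡ R z w ∧ not (inN (U z) w)) (FP.toℕ-fromℕ< lt)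
                   (R-step (F.fromℕ< lt) w)

  S≡R-at : ∀ i w → S (toℕ i) w ≡ R (toℕ i) w
  S≡R-at i = S≡R (toℕ i) (NP.<⇒≤ (FP.toℕ<n i))

  u-in-G : ∀ i → R (toℕ i) (u i) ≡ true
  u-in-G i = trans (esym (S≡R-at i (u i))) (degreeOne-in _ _ (U-ok′ (toℕ i) (FP.toℕ<n i)))

  -- later vertices avoid the closed neighbourhoods of earlier ones
  u-injective : ∀ {a b} → u a ≡ u b → a ≡ b
  u-injective {a} {b} e with FP.<-cmp a b
  ... | tri< lt _ _ = ⊥-elim (true-and-false (subst (λ z → inN (u a) z ≡ true) e (inN-self (u a)))
                                              (R-avoids a (toℕ b) (u b) lt (u-in-G b)))
  ... | tri≈ _ eq _ = eq
  ... | tri> _ _ gt = ⊥-elim (true-and-false (subst (λ z → inN (u b) z ≡ true) (esym e) (inN-self (u b)))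
                                              (R-avoids b (toℕ a) (u a) gt (u-in-G a)))

  forcing-set : SomeSetForcesUPM G
  forcing-set = k , u , u-injective , n≡2k , λ i →
    u-in-G i ,
    trans (count-cong (λ w → cong (adj G (u i) w ∧_) (esym (S≡R-at i w))))
          (degreeOne-count _ _ (U-ok′ (toℕ i) (FP.toℕ<n i)))

-- The theorem.  The direction (⇒) needs a vertex to seed the search; on the
-- empty graph the empty sequence forces.
unique⇒forcing : ∀ (n : ℕ) (G : Graph n) → IsCograph G ⊎ IsSplit G → HasUniquePM G → SomeSetForcesUPM G
unique⇒forcing zero    G class _             = 0 , (λ ()) , (λ {x} → ⊥-elim (no-vertex x)) , refl , (λ ())
  where
    no-vertex : Fin 0 → ⊥
    no-vertex ()
unique⇒forcing (suc m) G class (P₀ , unique) = UniqueToForcing.forcing-set G class P₀ unique zero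

theorem1 : ∀ (n : ℕ) (G : Graph n) → IsCograph G ⊎ IsSplit G →
    (HasUniquePM G → SomeSetForcesUPM G) × (SomeSetForcesUPM G → HasUniquePM G)
theorem1 n G class = unique⇒forcing n G class , λ (k , u , forces) → ForcingToUnique.unique-matching G u forces
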